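{- Let $H$ be a non-empty finite subgraph of $T_\infty$ all of whose connected components are ungrounded. Then $\partial(H)\ge\frac12(|E(H)|+3)$.
   Context: $T_\infty$ is the infinite tree whose vertex set is partitioned into levels $V_0,V_1,\dots$ such that each vertex of $V_j$ has exactly one neighbor in $V_{j+1}$ (its parent), each vertex of $V_j$ with $j\ge1$ has exactly two neighbors in $V_{j-1}$ (its children), there are no other edges, and any two vertices have a common ancestor; $V_0$ is the set of leaves. Subgraphs have no isolated vertices. $\partial(F)$ is the number of vertices of $F$ incident to at least one edge of $T_\infty$ not in $E(F)$. A subgraph is ungrounded if it is non-empty, connected, and contains no vertex of $V_0$. -}

module Defs where

open import Data.Nat using (ℕ; zero; suc; _/_)
open import Data.Nat.Properties using () renaming (_≟_ to _≟ℕ_)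
open import Data.Product using (_×_; _,_; proj₁; proj₂)
open import Data.Product.Properties using (≡-dec)
open import Data.List using (List; []; _∷_; length; concatMap; deduplicate; filter)
open import Data.Sum using (_⊎_)
open import Relation.Binary.PropositionalEquality using (_≡_; _≢_)
open import Relation.Binary.Definitions using (DecidableEquality)
open import Relation.Nullary using (¬_; Dec; yes; no)
open import Relation.Nullary.Decidable using (¬?)

-- A vertex is a pair (j , k): level j, index k ∈ ℕ within level j.
-- The parent of (j , k) is (j+1 , ⌊k/2⌋); hence each vertex of level
-- j+1, say (j+1 , m), has exactly the two children (j , 2m), (j , 2m+1).
-- Any two vertices have a common ancestor, since ⌊k/2^i⌋ = 0 for large i.
-- (These properties determine T∞ up to isomorphism.)

Vertex : Set
Vertex = ℕ × ℕ

_≟V_ : DecidableEquality Vertex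
_≟V_ = ≡-dec _≟ℕ_ _≟ℕ_

level : Vertex → ℕ
level = proj₁

parent : Vertex → Vertex
parent (j , k) = (suc j , k / 2)

-- Every edge of T∞ joins a vertex to its parent, so an edge is
-- identified uniquely by its lower endpoint (the child).
Edge : Set
Edge = Vertex

lower upper : Edge → Vertex
lower e = e
upper e = parent e

incident : Vertex → List Edge
incident (zero  , k) = (zero , k) ∷ []
incident (suc j , k) = (suc j , k) ∷ (j , 2 Data.Nat.* k) ∷ (j , suc (2 Data.Nat.* k)) ∷ []

-- Finite subgraphs (no isolated vertices): given by a finite list of
-- distinct edges; the vertices are the endpoints of those edges.

open import Data.List.Membership.DecPropositional _≟V_ using (_∈_; _∈?_)

Subgraph : Set
Subgraph = List Edge

-- E(H) has |E(H)| = length H (edges are required to be distinct).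
vertices : Subgraph → List Vertex
vertices H = deduplicate _≟V_ (concatMap (λ e → lower e ∷ upper e ∷ []) H)

IsBoundary : Subgraph → Vertex → Set
IsBoundary H v = ¬ (Data.List.Relation.Unary.All.All (λ e → e ∈ H) (incident v))
  where import Data.List.Relation.Unary.All

isBoundary? : (H : Subgraph) → (v : Vertex) → Dec (IsBoundary H v)
isBoundary? H v = ¬? (all? (λ e → e ∈? H) (incident v))
  where open import Data.List.Relation.Unary.All using (all?)

∂ : Subgraph → ℕ
∂ H = length (filter (isBoundary? H) (vertices H))

AdjIn : Subgraph → Vertex → Vertex → Set
AdjIn H u w = Data.Product.Σ Edge (λ e → e ∈ H × ((lower e ≡ u × upper e ≡ w) ⊎ (upper e ≡ u × lower e ≡ w)))

data Reach (H : Subgraph) : Vertex → Vertex → Set where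
  here : ∀ {u} → Reach H u u
  step : ∀ {u x w} → AdjIn H u x → Reach H x w → Reach H u w

-- A subgraph is ungrounded if it contains no vertex of V₀ (it is also
-- non-empty and connected; components are so automatically).
-- Every connected component of H is ungrounded: for each vertex v of H,
-- the component of v (vertices reachable from v in H) avoids level 0.
AllComponentsUngrounded : Subgraph → Set
AllComponentsUngrounded H =
  ∀ v → v ∈ vertices H → ∀ w → Reach H v w → level w ≢ 0

-- Let t be an edge of H of maximal level. The lower endpoints of the edges of H are
-- distinct vertices of H, and parent t is a further one, so |V(H)| ≥ |E(H)| + 1.
-- A vertex with all its incident edges in H is no leaf (H is ungrounded), so its two
-- child edges lie in H; these are distinct for distinct such vertices and differ from t,
-- so 2 i + 1 ≤ |E(H)| for the number i of these interior vertices. Hence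
-- ∂(H) = |V(H)| − i ≥ (|E(H)| + 3) / 2.
module Submission where

open import Defs
open import Data.Nat using (zero; suc; _+_; _*_; _≤_; _<_; z≤n; s≤s)
open import Data.Nat.Properties
open import Data.Nat.Tactic.RingSolver using (solve-∀)
open import Data.List using (List; []; _∷_; _++_; length; map; filter)
open import Data.List.Properties using (length-++; length-map)
open import Data.List.Extrema.Nat using (argmax; argmax-sel; f[⊥]≤f[argmax]; f[xs]≤f[argmax])
open import Data.List.Membership.Propositional using (_∈_; _∉_)
open import Data.List.Membership.Propositional.Properties
open import Data.List.Membership.DecPropositional _≟V_ using (_∈?_)
open import Data.List.Relation.Binary.Subset.Propositional using (_⊆_)
open import Data.List.Relation.Unary.Any as Any using (here; there)
open import Data.List.Relation.Unary.All as All using (All; _∷_; all?)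
open import Data.List.Relation.Unary.AllPairs using (_∷_)
open import Data.List.Relation.Unary.Unique.Propositional using (Unique)
import Data.List.Relation.Unary.Unique.Propositional.Properties as Unique
import Data.List.Relation.Unary.Unique.DecPropositional.Properties as UniqueDec
open import Data.Product using (∃-syntax; _×_; _,_; proj₁; proj₂)
open import Data.Empty using (⊥-elim)
open import Data.Sum using (_⊎_; inj₁; inj₂; [_,_]′)
open import Relation.Nullary using (¬_; yes; no)
open import Relation.Nullary.Decidable using (decidable-stable)
open import Relation.Unary using (Pred; Decidable)
open import Relation.Unary.Properties using (∁?)
open import Relation.Binary.PropositionalEquality
  using (_≡_; _≢_; refl; sym; trans; cong; cong₂; subst₂; module ≡-Reasoning)

Unique-⊆⇒length≤ : ∀ {a} {A : Set a} {xs ys : List A} → Unique xs → xs ⊆ ys → length xs ≤ length ys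
Unique-⊆⇒length≤ {xs = []} _ _ = z≤n
Unique-⊆⇒length≤ {xs = x ∷ xs} {ys} (x∉xs ∷ !xs) xs⊆ys with ∈-∃++ (xs⊆ys (here refl))
... | us , vs , refl =
  subst₂ _≤_ refl (sym length-us++x∷vs) (s≤s (Unique-⊆⇒length≤ !xs xs⊆us++vs))
  where
  length-us++x∷vs : length (us ++ x ∷ vs) ≡ suc (length (us ++ vs))
  length-us++x∷vs = begin
    length (us ++ x ∷ vs)       ≡⟨ length-++ us ⟩
    length us + suc (length vs) ≡⟨ +-suc (length us) (length vs) ⟩
    suc (length us + length vs) ≡⟨ cong suc (length-++ us) ⟨
    suc (length (us ++ vs))     ∎
    where open ≡-Reasoning
  xs⊆us++vs : xs ⊆ us ++ vs
  xs⊆us++vs y∈xs with ∈-++⁻ us (xs⊆ys (there y∈xs))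
  ... | inj₁ y∈us = ∈-++⁺ˡ y∈us
  ... | inj₂ (here y≡x) = ⊥-elim (All.lookup x∉xs y∈xs (sym y≡x))
  ... | inj₂ (there y∈vs) = ∈-++⁺ʳ us y∈vs

length-filter+length-filter-∁ : ∀ {a p} {A : Set a} {P : Pred A p} (P? : Decidable P) (xs : List A) →
  length (filter P? xs) + length (filter (∁? P?) xs) ≡ length xs
length-filter+length-filter-∁ P? [] = refl
length-filter+length-filter-∁ P? (x ∷ xs) with P? x
... | yes _ = cong suc (length-filter+length-filter-∁ P? xs)
... | no _ = trans (+-suc _ _) (cong suc (length-filter+length-filter-∁ P? xs))

IsHighestEdge : Subgraph → Edge → Set
IsHighestEdge H t = t ∈ H × (∀ {e} → e ∈ H → level e ≤ level t)

highestEdge : (H : Subgraph) → H ≢ [] → ∃[ t ] IsHighestEdge H t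
highestEdge [] H≢[] = ⊥-elim (H≢[] refl)
highestEdge (e ∷ es) _ = t , t∈H , maximal
  where
  t : Edge
  t = argmax level e es
  t∈H : t ∈ e ∷ es
  t∈H with argmax-sel level e es
  ... | inj₁ t≡e = here t≡e
  ... | inj₂ t∈es = there t∈es
  maximal : ∀ {f} → f ∈ e ∷ es → level f ≤ level t
  maximal (here refl) = f[⊥]≤f[argmax] {f = level} e es
  maximal (there f∈es) = All.lookup (f[xs]≤f[argmax] {f = level} e es) f∈es

parent-of-highest∉ : ∀ {H t} → IsHighestEdge H t → parent t ∉ H
parent-of-highest∉ (_ , maximal) p∈H = n≮n _ (maximal p∈H)

endpoints∈vertices : ∀ {H e} → e ∈ H → e ∈ vertices H × parent e ∈ vertices H
endpoints∈vertices e∈H =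
  ∈-deduplicate⁺ _≟V_ (∈-concatMap⁺ endpoints (Any.map (λ { refl → here refl }) e∈H)) ,
  ∈-deduplicate⁺ _≟V_ (∈-concatMap⁺ endpoints (Any.map (λ { refl → there (here refl) }) e∈H))
  where
  endpoints : Edge → List Vertex
  endpoints e = lower e ∷ upper e ∷ []

vertices-Unique : ∀ H → Unique (vertices H)
vertices-Unique H = UniqueDec.deduplicate-! _≟V_ _

edges<vertices : ∀ {H t} → Unique H → IsHighestEdge H t → length H < length (vertices H)
edges<vertices {H} {t} !H highest = Unique-⊆⇒length≤ (All.tabulate p≢ ∷ !H) p∷H⊆V
  where
  p≢ : ∀ {e} → e ∈ H → parent t ≢ e
  p≢ e∈H refl = parent-of-highest∉ highest e∈H
  p∷H⊆V : parent t ∷ H ⊆ vertices H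
  p∷H⊆V (here refl) = proj₂ (endpoints∈vertices (proj₁ highest))
  p∷H⊆V (there e∈H) = proj₁ (endpoints∈vertices e∈H)

Interior : Subgraph → List Vertex
Interior H = filter (∁? (isBoundary? H)) (vertices H)

∂+interior≡vertices : ∀ H → ∂ H + length (Interior H) ≡ length (vertices H)
∂+interior≡vertices H = length-filter+length-filter-∁ (isBoundary? H) (vertices H)

interior⇒incident⊆ : ∀ H {v} → v ∈ Interior H → v ∈ vertices H × All (_∈ H) (incident v)
interior⇒incident⊆ H {v} v∈I with ∈-filter⁻ (∁? (isBoundary? H)) v∈I
... | v∈V , ¬boundary = v∈V , decidable-stable (all? (_∈? H) (incident v)) ¬boundary

raise : Vertex → Vertex
raise (j , k) = (suc j , k)

-- For a vertex (1 + j , k) these are the raises of its children (j , 2k) and (j , 2k + 1);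
-- indexing by the parent avoids truncated subtraction on the level.
leftChild↑ rightChild↑ : Vertex → Vertex
leftChild↑ (j , k) = (j , 2 * k)
rightChild↑ (j , k) = (j , suc (2 * k))

children↑ : List Vertex → List Vertex
children↑ vs = map leftChild↑ vs ++ map rightChild↑ vs

length-children↑ : ∀ vs → length (children↑ vs) ≡ 2 * length vs
length-children↑ vs = begin
  length (map leftChild↑ vs ++ map rightChild↑ vs)     ≡⟨ length-++ (map leftChild↑ vs) ⟩
  length (map leftChild↑ vs) + length (map rightChild↑ vs)
    ≡⟨ cong₂ _+_ (length-map leftChild↑ vs) (length-map rightChild↑ vs) ⟩
  length vs + length vs                                ≡⟨ cong (length vs +_) (+-identityʳ (length vs)) ⟨
  2 * length vs                                        ∎
  where open ≡-Reasoning

children↑-Unique : ∀ {vs} → Unique vs → Unique (children↑ vs)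
children↑-Unique {vs} !vs = Unique.++⁺ (Unique.map⁺ leftChild↑-injective !vs)
                                       (Unique.map⁺ rightChild↑-injective !vs) left-right-disjoint
  where
  leftChild↑-injective : ∀ {v w} → leftChild↑ v ≡ leftChild↑ w → v ≡ w
  leftChild↑-injective {j , k} {j′ , k′} eq
    with refl ← cong proj₁ eq | refl ← *-cancelˡ-≡ k k′ 2 (cong proj₂ eq) = refl
  rightChild↑-injective : ∀ {v w} → rightChild↑ v ≡ rightChild↑ w → v ≡ w
  rightChild↑-injective {j , k} {j′ , k′} eq
    with refl ← cong proj₁ eq | refl ← *-cancelˡ-≡ k k′ 2 (suc-injective (cong proj₂ eq)) = refl
  left-right-disjoint : ∀ {w} → ¬ (w ∈ map leftChild↑ vs × w ∈ map rightChild↑ vs)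
  left-right-disjoint (w∈left , w∈right)
    with u , _ , refl ← ∈-map⁻ leftChild↑ w∈left | v , _ , eq ← ∈-map⁻ rightChild↑ w∈right
    = even≢odd (proj₂ u) (proj₂ v) (cong proj₂ eq)

∈-children↑⁻ : ∀ vs {w} → w ∈ children↑ vs →
  ∃[ v ] v ∈ vs × (w ≡ leftChild↑ v ⊎ w ≡ rightChild↑ v)
∈-children↑⁻ vs w∈ with ∈-++⁻ (map leftChild↑ vs) w∈
... | inj₁ w∈left with v , v∈vs , refl ← ∈-map⁻ leftChild↑ w∈left = v , v∈vs , inj₁ refl
... | inj₂ w∈right with v , v∈vs , refl ← ∈-map⁻ rightChild↑ w∈right = v , v∈vs , inj₂ refl

interior-children↑∈ : ∀ H {v} → AllComponentsUngrounded H → v ∈ Interior H →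
  v ∈ H × leftChild↑ v ∈ map raise H × rightChild↑ v ∈ map raise H
interior-children↑∈ H {zero , k} ungrounded v∈I =
  ⊥-elim (ungrounded _ (proj₁ (interior⇒incident⊆ H v∈I)) _ Reach.here refl)
interior-children↑∈ H {suc j , k} _ v∈I
  with _ , (v∈H ∷ left∈H ∷ right∈H ∷ _) ← interior⇒incident⊆ H v∈I
  = v∈H , ∈-map⁺ raise left∈H , ∈-map⁺ raise right∈H

twice-interior<edges : ∀ {H t} → AllComponentsUngrounded H → IsHighestEdge H t →
  2 * length (Interior H) < length H
twice-interior<edges {H} {t} ungrounded (t∈H , maximal) =
  subst₂ _≤_ (cong suc (length-children↑ I)) (length-map raise H)
    (Unique-⊆⇒length≤ (All.tabulate raise-t∉children ∷ children↑-Unique !I) ⊆raised-edges)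
  where
  I : List Vertex
  I = Interior H
  !I : Unique I
  !I = Unique.filter⁺ (∁? (isBoundary? H)) (vertices-Unique H)
  raise-t∉children : ∀ {w} → w ∈ children↑ I → raise t ≢ w
  raise-t∉children w∈ refl with v , v∈I , raise-t≡child ← ∈-children↑⁻ I w∈ =
    n≮n (level t) (≤-trans (≤-reflexive ([ cong level , cong level ]′ raise-t≡child))
                           (maximal (proj₁ (interior-children↑∈ H ungrounded v∈I))))
  ⊆raised-edges : raise t ∷ children↑ I ⊆ map raise H
  ⊆raised-edges (here refl) = ∈-map⁺ raise t∈H
  ⊆raised-edges (there w∈) with ∈-children↑⁻ I w∈
  ... | v , v∈I , inj₁ refl = proj₁ (proj₂ (interior-children↑∈ H ungrounded v∈I))
  ... | v , v∈I , inj₂ refl = proj₂ (proj₂ (interior-children↑∈ H ungrounded v∈I))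

boundary-bound : ∀ b i {m n} → b + i ≡ n → m < n → 2 * i < m → m + 3 ≤ 2 * b
boundary-bound b i {m} refl m<n 2i<m = +-cancelʳ-≤ (2 * i) (m + 3) (2 * b) (begin
  m + 3 + 2 * i         ≡⟨ regroup m i ⟩
  2 + (m + suc (2 * i)) ≤⟨ +-monoʳ-≤ 2 (+-monoʳ-≤ m 2i<m) ⟩
  2 + (m + m)           ≡⟨ double-suc m ⟩
  2 * suc m             ≤⟨ *-monoʳ-≤ 2 m<n ⟩
  2 * (b + i)           ≡⟨ *-distribˡ-+ 2 b i ⟩
  2 * b + 2 * i         ∎)
  where
  open ≤-Reasoning
  regroup : ∀ m i → m + 3 + 2 * i ≡ 2 + (m + suc (2 * i))
  regroup = solve-∀
  double-suc : ∀ m → 2 + (m + m) ≡ 2 * suc m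
  double-suc = solve-∀

lemma3p10 : (H : Subgraph) → H ≢ [] → Unique H → AllComponentsUngrounded H →
    length H + 3 ≤ 2 * ∂ H
lemma3p10 H H≢[] !H ungrounded with _ , highest ← highestEdge H H≢[] =
  boundary-bound (∂ H) (length (Interior H)) (∂+interior≡vertices H)
    (edges<vertices !H highest) (twice-interior<edges ungrounded highest)
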